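{- Let $d\ge1$, let $S, T \subset [d]$, and let $\bar I_1, \dots, \bar I_\kappa$ be a partition of $[2d] \setminus (S \cup (T+d))$ into $\kappa$ nonempty sets, where $T + d = \{t+d : t\in T\}$. Let $\bar I = \bigcup_{j\in[\kappa]:\, \bar I_j \subset [d]} \bar I_j$, $\bar I' = \bigcup_{j\in[\kappa]:\, \bar I_j \subset [2d]\setminus[d]} \bar I_j$, and $\bar J = [2d] \setminus (S\cup(T+d)\cup\bar I\cup\bar I')$. Then \[ \frac14 |\bar J| + \frac12 (|\bar I| + |\bar I'|) \geq \frac{\kappa}{2}. \] -}

module Defs where

open import Data.Nat using (ℕ; _+_)
open import Data.Bool using (true; false; if_then_else_)
open import Data.Fin using (Fin)
open import Data.Fin.Subset using (Subset; ⊥; ⋃; ∁; _∪_; _⊆_)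
open import Data.Fin.Subset.Properties using (_⊆?_)
open import Data.List using (List; map; allFin)
open import Data.Vec using (_++_; replicate)
open import Relation.Nullary using (does)

-- [2d] is modelled as Fin (d + d); indices 0..d-1 form [d], indices d..2d-1 form [2d] \ [d].

lowerHalf : (d : ℕ) → Subset (d + d)
lowerHalf d = replicate d true ++ replicate d false

upperHalf : (d : ℕ) → Subset (d + d)
upperHalf d = replicate d false ++ replicate d true

embedLow : {d : ℕ} → Subset d → Subset (d + d)
embedLow {d} S = S ++ replicate d false

shiftUp : {d : ℕ} → Subset d → Subset (d + d)
shiftUp {d} T = replicate d false ++ T

unionBlocksIn : {n κ : ℕ} → (Fin κ → Subset n) → Subset n → Subset n
unionBlocksIn {κ = κ} P A =
  ⋃ (map (λ j → if does (P j ⊆? A) then P j else ⊥) (allFin κ))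

-- Charge every block two distinct tokens in (J ∪ I ∪ I') ⊎ (I ∪ I'). A block inside one half
-- lies in I ∪ I' and contributes one of its points on both sides. Any other block has a point
-- outside the lower half and a point outside the upper half; these are distinct, lie in J, and
-- go on the left. Disjointness of the blocks makes the tokens pairwise distinct, so
-- 2κ ≤ ∣J ∪ I ∪ I'∣ + ∣I ∪ I'∣ ≤ ∣J∣ + 2(∣I∣ + ∣I'∣).
module Submission where

open import Defs
open import Data.Bool using (if_then_else_)
open import Data.Fin using (Fin; zero; suc; toℕ; fromℕ<; splitAt; join; _↑ˡ_; _↑ʳ_)
open import Data.Fin.Properties using (¬∀⟶∃¬; injective⇒≤; toℕ-fromℕ<; +↔⊎; _≟_)
open import Data.Fin.Subset
  using (Subset; inside; outside; ⊥; ⋃; ∁; _∪_; _∩_; ∣_∣; _∈_; _∉_; _⊆_; Nonempty; Empty)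
open import Data.Fin.Subset.Properties
  using (_⊆?_; _∈?_; ∉⊥; ∈⊤; p⊆p∪q; q⊆p∪q; x∈p∪q⁻; x∈p∩q⁺; x∈∁p⇒x∉p; x∉p⇒x∈∁p)
open import Data.List using (List; []; _∷_; map; allFin)
open import Data.List.Membership.Propositional using () renaming (_∈_ to _∈ₗ_)
open import Data.List.Membership.Propositional.Properties using (∈-map⁺; ∈-map⁻; ∈-allFin)
open import Data.List.Relation.Unary.Any using (here; there)
open import Data.Nat using (ℕ; suc; _≥_; _+_; _*_; _≤_; _<_; z≤n; s≤s)
open import Data.Nat.Properties using (≤-reflexive; ≤-trans; +-mono-≤; +-monoʳ-≤; +-suc; +-assoc; +-identityʳ; n≤1+n; suc-injective; module ≤-Reasoning)
open import Data.Product using (∃; _×_; _,_)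
open import Data.Sum using (_⊎_; inj₁; inj₂; [_,_]′; reduce) renaming (map to ⊎-map)
open import Data.Vec using (_∷_; []; _++_; replicate; here; there)
open import Function using (_∘_)
open import Function.Bundles using (Injection)
open import Function.Definitions using (Injective)
open import Function.Properties.Inverse using (↔⇒↣; ↔-sym)
open import Relation.Binary.PropositionalEquality using (_≡_; _≢_; refl; sym; cong; subst; module ≡-Reasoning)
open import Relation.Nullary using (¬_; yes; no; does; contradiction)
open import Relation.Nullary.Decidable using (dec-true; _→-dec_)

private
  variable
    m n κ : ℕ
    p q : Subset n
    x : Fin n

∉-∪⁺ : x ∉ p → x ∉ q → x ∉ p ∪ q
∉-∪⁺ {p = p} {q} x∉p x∉q x∈p∪q = [ x∉p , x∉q ]′ (x∈p∪q⁻ p q x∈p∪q)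

⊈⇒∃∉ : ¬ p ⊆ q → ∃ λ x → x ∈ p × x ∉ q
⊈⇒∃∉ {n} {p} {q} p⊈q with ¬∀⟶∃¬ n (λ x → x ∈ p → x ∈ q) (λ x → x ∈? p →-dec x ∈? q) (λ h → p⊈q (h _))
... | x , ¬[x∈p⇒x∈q] with x ∈? p
...   | yes x∈p = x , x∈p , λ x∈q → ¬[x∈p⇒x∈q] (λ _ → x∈q)
...   | no x∉p  = contradiction (λ x∈p → contradiction x∈p x∉p) ¬[x∈p⇒x∈q]

∈-⋃⁺ : ∀ (ps : List (Subset n)) → p ∈ₗ ps → x ∈ p → x ∈ ⋃ ps
∈-⋃⁺ (p ∷ ps) (here refl) x∈p = p⊆p∪q (⋃ ps) x∈p
∈-⋃⁺ (p ∷ ps) (there p∈ps) x∈p = q⊆p∪q p (⋃ ps) (∈-⋃⁺ ps p∈ps x∈p)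

∈-⋃⁻ : ∀ (ps : List (Subset n)) → x ∈ ⋃ ps → ∃ λ p → p ∈ₗ ps × x ∈ p
∈-⋃⁻ [] x∈⊥ = contradiction x∈⊥ ∉⊥
∈-⋃⁻ (p ∷ ps) x∈ with x∈p∪q⁻ p (⋃ ps) x∈
... | inj₁ x∈p = p , here refl , x∈p
... | inj₂ x∈⋃ps with ∈-⋃⁻ ps x∈⋃ps
...   | q , q∈ps , x∈q = q , there q∈ps , x∈q

∈-++⁺ˡ : ∀ (p : Subset m) (q : Subset n) {x} → x ∈ p → x ↑ˡ n ∈ p ++ q
∈-++⁺ˡ (_ ∷ p) q here = here
∈-++⁺ˡ (_ ∷ p) q (there x∈p) = there (∈-++⁺ˡ p q x∈p)

∈-++⁺ʳ : ∀ (p : Subset m) (q : Subset n) {x} → x ∈ q → m ↑ʳ x ∈ p ++ q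
∈-++⁺ʳ [] q x∈q = x∈q
∈-++⁺ʳ (_ ∷ p) q x∈q = there (∈-++⁺ʳ p q x∈q)

∣p++q∣≡∣p∣+∣q∣ : ∀ (p : Subset m) (q : Subset n) → ∣ p ++ q ∣ ≡ ∣ p ∣ + ∣ q ∣
∣p++q∣≡∣p∣+∣q∣ [] q = refl
∣p++q∣≡∣p∣+∣q∣ (inside ∷ p) q = cong (1 +_) (∣p++q∣≡∣p∣+∣q∣ p q)
∣p++q∣≡∣p∣+∣q∣ (outside ∷ p) q = ∣p++q∣≡∣p∣+∣q∣ p q

∣p∪q∣≤∣p∣+∣q∣ : ∀ (p q : Subset n) → ∣ p ∪ q ∣ ≤ ∣ p ∣ + ∣ q ∣
∣p∪q∣≤∣p∣+∣q∣ [] [] = z≤n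
∣p∪q∣≤∣p∣+∣q∣ (outside ∷ p) (outside ∷ q) = ∣p∪q∣≤∣p∣+∣q∣ p q
∣p∪q∣≤∣p∣+∣q∣ (inside ∷ p) (outside ∷ q) = s≤s (∣p∪q∣≤∣p∣+∣q∣ p q)
∣p∪q∣≤∣p∣+∣q∣ (inside ∷ p) (inside ∷ q) =
  s≤s (≤-trans (∣p∪q∣≤∣p∣+∣q∣ p q) (+-monoʳ-≤ ∣ p ∣ (n≤1+n ∣ q ∣)))
∣p∪q∣≤∣p∣+∣q∣ (outside ∷ p) (inside ∷ q) =
  ≤-trans (s≤s (∣p∪q∣≤∣p∣+∣q∣ p q)) (≤-reflexive (sym (+-suc ∣ p ∣ ∣ q ∣)))

rank : Subset n → Fin n → ℕ
rank (_ ∷ p) zero = 0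
rank (inside ∷ p) (suc x) = 1 + rank p x
rank (outside ∷ p) (suc x) = rank p x

rank<∣p∣ : ∀ (p : Subset n) {x} → x ∈ p → rank p x < ∣ p ∣
rank<∣p∣ (inside ∷ p) here = s≤s z≤n
rank<∣p∣ (inside ∷ p) (there x∈p) = s≤s (rank<∣p∣ p x∈p)
rank<∣p∣ (outside ∷ p) (there x∈p) = rank<∣p∣ p x∈p

rank-injective : ∀ (p : Subset n) {x y} → x ∈ p → y ∈ p → rank p x ≡ rank p y → x ≡ y
rank-injective (inside ∷ p) here here _ = refl
rank-injective (inside ∷ p) (there x∈p) (there y∈p) eq = cong suc (rank-injective p x∈p y∈p (suc-injective eq))
rank-injective (outside ∷ p) (there x∈p) (there y∈p) eq = cong suc (rank-injective p x∈p y∈p eq)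

-- Ranking the elements of p turns an injection into p into one into Fin ∣ p ∣.
injective⇒≤∣p∣ : ∀ (p : Subset n) {f : Fin m → Fin n} →
                 Injective _≡_ _≡_ f → (∀ i → f i ∈ p) → m ≤ ∣ p ∣
injective⇒≤∣p∣ {m = m} p {f} f-injective f∈p = injective⇒≤ g-injective
  where
  g : Fin m → Fin ∣ p ∣
  g i = fromℕ< (rank<∣p∣ p (f∈p i))

  g-injective : Injective _≡_ _≡_ g
  g-injective {i} {j} eq = f-injective (rank-injective p (f∈p i) (f∈p j) (begin
    rank p (f i)  ≡⟨ sym (toℕ-fromℕ< (rank<∣p∣ p (f∈p i))) ⟩
    toℕ (g i)     ≡⟨ cong toℕ eq ⟩
    toℕ (g j)     ≡⟨ toℕ-fromℕ< (rank<∣p∣ p (f∈p j)) ⟩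
    rank p (f j)  ∎))
    where open ≡-Reasoning

injective⇒≤∣p∣+∣q∣ : ∀ {k l} (p : Subset m) (q : Subset n) {f : Fin k ⊎ Fin l → Fin m ⊎ Fin n} →
                     Injective _≡_ _≡_ f → (∀ i → [ _∈ p , _∈ q ]′ (f i)) → k + l ≤ ∣ p ∣ + ∣ q ∣
injective⇒≤∣p∣+∣q∣ {m} {n} {k} {l} p q {f} f-injective f∈ = begin
  k + l          ≤⟨ injective⇒≤∣p∣ (p ++ q) g-injective (λ i → join∈ (f (splitAt k i)) (f∈ (splitAt k i))) ⟩
  ∣ p ++ q ∣     ≡⟨ ∣p++q∣≡∣p∣+∣q∣ p q ⟩
  ∣ p ∣ + ∣ q ∣  ∎
  where
  open ≤-Reasoning
  g : Fin (k + l) → Fin (m + n)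
  g = join m n ∘ f ∘ splitAt k

  g-injective : Injective _≡_ _≡_ g
  g-injective = Injection.injective (↔⇒↣ +↔⊎) ∘ f-injective ∘ Injection.injective (↔⇒↣ (↔-sym +↔⊎))

  join∈ : ∀ y → [ _∈ p , _∈ q ]′ y → join m n y ∈ p ++ q
  join∈ (inj₁ y) = ∈-++⁺ˡ p q
  join∈ (inj₂ y) = ∈-++⁺ʳ p q

blockIfIn : (Fin κ → Subset n) → Subset n → Fin κ → Subset n
blockIfIn P A j = if does (P j ⊆? A) then P j else ⊥

∈-unionBlocksIn⁺ : ∀ (P : Fin κ → Subset n) {A} j → P j ⊆ A → x ∈ P j → x ∈ unionBlocksIn P A
∈-unionBlocksIn⁺ P {A} j Pj⊆A x∈Pj =
  ∈-⋃⁺ (map (blockIfIn P A) (allFin _)) (∈-map⁺ (blockIfIn P A) (∈-allFin j))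
    (subst (λ b → _ ∈ (if b then P j else ⊥)) (sym (dec-true (P j ⊆? A) Pj⊆A)) x∈Pj)

∈-unionBlocksIn⁻ : ∀ (P : Fin κ → Subset n) {A} → x ∈ unionBlocksIn P A → ∃ λ j → x ∈ P j × P j ⊆ A
∈-unionBlocksIn⁻ P {A} x∈ with ∈-⋃⁻ (map (blockIfIn P A) (allFin _)) x∈
... | _ , B∈ , x∈B with ∈-map⁻ (blockIfIn P A) B∈
...   | j , _ , refl = j , selected x∈B
  where
  selected : x ∈ blockIfIn P A j → x ∈ P j × P j ⊆ A
  selected x∈ with P j ⊆? A
  ... | yes Pj⊆A = x∈ , Pj⊆A
  ... | no _ = contradiction x∈ ∉⊥

module _ (P : Fin κ → Subset n) (disjoint : ∀ j k → j ≢ k → Empty (P j ∩ P k)) where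

  block-unique : ∀ {j k} → x ∈ P j → x ∈ P k → j ≡ k
  block-unique {j = j} {k} x∈Pj x∈Pk with j ≟ k
  ... | yes j≡k = j≡k
  ... | no j≢k = contradiction (_ , x∈p∩q⁺ (x∈Pj , x∈Pk)) (disjoint j k j≢k)

  ∉-unionBlocksIn : ∀ {A j} → x ∈ P j → ¬ P j ⊆ A → x ∉ unionBlocksIn P A
  ∉-unionBlocksIn x∈Pj Pj⊈A x∈ with ∈-unionBlocksIn⁻ P x∈
  ... | k , x∈Pk , Pk⊆A with block-unique x∈Pj x∈Pk
  ...   | refl = Pj⊈A Pk⊆A

module _ (P : Fin κ → Subset n)
         (nonempty : ∀ j → Nonempty (P j))
         (disjoint : ∀ j k → j ≢ k → Empty (P j ∩ P k))
         {L U : Subset n} (cover : ∀ x → x ∈ L ⊎ x ∈ U)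
         (J : Subset n)
         (∈J : ∀ {j x} → x ∈ P j → x ∉ unionBlocksIn P L → x ∉ unionBlocksIn P U → x ∈ J) where

  private
    I I' : Subset n
    I = unionBlocksIn P L
    I' = unionBlocksIn P U

    Counted : Fin n ⊎ Fin n → Set
    Counted = [ _∈ J ∪ (I ∪ I') , _∈ I ∪ I' ]′

    record TokenPair (j : Fin κ) : Set where
      field
        first second : Fin n ⊎ Fin n
        first∈P : reduce first ∈ P j
        second∈P : reduce second ∈ P j
        first≢second : first ≢ second
        first-counted : Counted first
        second-counted : Counted second

    doubled : ∀ {j x} → x ∈ P j → x ∈ I ∪ I' → TokenPair j
    doubled {x = x} x∈Pj x∈I∪I' = record
      { first = inj₁ x ; second = inj₂ x
      ; first∈P = x∈Pj ; second∈P = x∈Pj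
      ; first≢second = λ ()
      ; first-counted = q⊆p∪q J (I ∪ I') x∈I∪I' ; second-counted = x∈I∪I'
      }

    straddling : ∀ {j a b} → a ∈ P j → b ∈ P j → a ∉ L → b ∉ U → TokenPair j
    straddling {j} {a} {b} a∈Pj b∈Pj a∉L b∉U = record
      { first = inj₁ a ; second = inj₁ b
      ; first∈P = a∈Pj ; second∈P = b∈Pj
      ; first≢second = λ { refl → [ a∉L , b∉U ]′ (cover a) }
      ; first-counted = p⊆p∪q (I ∪ I') (Pj⊆J a∈Pj)
      ; second-counted = p⊆p∪q (I ∪ I') (Pj⊆J b∈Pj)
      }
      where
      Pj⊆J : P j ⊆ J
      Pj⊆J x∈Pj = ∈J x∈Pj
        (∉-unionBlocksIn P disjoint x∈Pj (λ Pj⊆L → a∉L (Pj⊆L a∈Pj)))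
        (∉-unionBlocksIn P disjoint x∈Pj (λ Pj⊆U → b∉U (Pj⊆U b∈Pj)))

    tokenPair : ∀ j → TokenPair j
    tokenPair j with P j ⊆? L | P j ⊆? U | nonempty j
    ... | yes Pj⊆L | _ | _ , x∈Pj = doubled x∈Pj (p⊆p∪q I' (∈-unionBlocksIn⁺ P j Pj⊆L x∈Pj))
    ... | no _ | yes Pj⊆U | _ , x∈Pj = doubled x∈Pj (q⊆p∪q I I' (∈-unionBlocksIn⁺ P j Pj⊆U x∈Pj))
    ... | no Pj⊈L | no Pj⊈U | _ with ⊈⇒∃∉ Pj⊈L | ⊈⇒∃∉ Pj⊈U
    ...   | a , a∈Pj , a∉L | b , b∈Pj , b∉U = straddling a∈Pj b∈Pj a∉L b∉U

    token : Fin κ ⊎ Fin κ → Fin n ⊎ Fin n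
    token (inj₁ j) = TokenPair.first (tokenPair j)
    token (inj₂ j) = TokenPair.second (tokenPair j)

    token∈P : ∀ s → reduce (token s) ∈ P (reduce s)
    token∈P (inj₁ j) = TokenPair.first∈P (tokenPair j)
    token∈P (inj₂ j) = TokenPair.second∈P (tokenPair j)

    token-counted : ∀ s → Counted (token s)
    token-counted (inj₁ j) = TokenPair.first-counted (tokenPair j)
    token-counted (inj₂ j) = TokenPair.second-counted (tokenPair j)

    token-injective : Injective _≡_ _≡_ token
    token-injective {s} {t} eq = injective-within-block s t eq
      (block-unique P disjoint (token∈P s) (subst (λ y → reduce y ∈ P (reduce t)) (sym eq) (token∈P t)))
      where
      injective-within-block : ∀ s t → token s ≡ token t → reduce s ≡ reduce t → s ≡ t
      injective-within-block (inj₁ j) (inj₁ _) _ refl = refl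
      injective-within-block (inj₂ j) (inj₂ _) _ refl = refl
      injective-within-block (inj₁ j) (inj₂ _) eq refl = contradiction eq (TokenPair.first≢second (tokenPair j))
      injective-within-block (inj₂ j) (inj₁ _) eq refl = contradiction (sym eq) (TokenPair.first≢second (tokenPair j))

  2*κ≤∣J∣+2*[∣I∣+∣I'∣] : 2 * κ ≤ ∣ J ∣ + 2 * (∣ unionBlocksIn P L ∣ + ∣ unionBlocksIn P U ∣)
  2*κ≤∣J∣+2*[∣I∣+∣I'∣] = begin
    2 * κ                                  ≡⟨ cong (κ +_) (+-identityʳ κ) ⟩
    κ + κ                                  ≤⟨ injective⇒≤∣p∣+∣q∣ (J ∪ (I ∪ I')) (I ∪ I') token-injective token-counted ⟩
    ∣ J ∪ (I ∪ I') ∣ + ∣ I ∪ I' ∣          ≤⟨ +-mono-≤ (≤-trans (∣p∪q∣≤∣p∣+∣q∣ J (I ∪ I')) (+-monoʳ-≤ ∣ J ∣ ∣I∪I'∣≤)) ∣I∪I'∣≤ ⟩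
    ∣ J ∣ + i + i                          ≡⟨ +-assoc ∣ J ∣ i i ⟩
    ∣ J ∣ + (i + i)                        ≡⟨ cong (λ k → ∣ J ∣ + (i + k)) (sym (+-identityʳ i)) ⟩
    ∣ J ∣ + 2 * i                          ∎
    where
    open ≤-Reasoning
    i : ℕ
    i = ∣ I ∣ + ∣ I' ∣
    ∣I∪I'∣≤ : ∣ I ∪ I' ∣ ≤ i
    ∣I∪I'∣≤ = ∣p∪q∣≤∣p∣+∣q∣ I I'

halves-cover : ∀ m {n} (x : Fin (m + n)) →
               x ∈ replicate m inside ++ replicate n outside ⊎ x ∈ replicate m outside ++ replicate n inside
halves-cover 0 x = inj₂ ∈⊤
halves-cover (suc m) zero = inj₁ here
halves-cover (suc m) (suc x) = ⊎-map there there (halves-cover m x)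

lemma8 : (d κ : ℕ) → 1 ≤ d →
         (S T : Subset d) →
         (P : Fin κ → Subset (d + d)) →
         (∀ j → Nonempty (P j)) →
         (∀ j k → j ≢ k → Empty (P j ∩ P k)) →
         ⋃ (map P (allFin κ)) ≡ ∁ (embedLow S ∪ shiftUp T) →
         let Ī  = unionBlocksIn P (lowerHalf d)
             Ī' = unionBlocksIn P (upperHalf d)
             J̄  = ∁ (embedLow S ∪ shiftUp T ∪ Ī ∪ Ī')
         in ∣ J̄ ∣ + 2 * (∣ Ī ∣ + ∣ Ī' ∣) ≥ 2 * κ
lemma8 d κ _ S T P nonempty disjoint partition =
  2*κ≤∣J∣+2*[∣I∣+∣I'∣] P nonempty disjoint (halves-cover d) _ ∈J̄
  where
  ∉S∪T : ∀ {j x} → x ∈ P j → x ∉ embedLow S ∪ shiftUp T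
  ∉S∪T {j} x∈Pj = x∈∁p⇒x∉p (subst (_ ∈_) partition (∈-⋃⁺ (map P (allFin κ)) (∈-map⁺ P (∈-allFin j)) x∈Pj))

  ∈J̄ : ∀ {j x} → x ∈ P j → x ∉ unionBlocksIn P (lowerHalf d) → x ∉ unionBlocksIn P (upperHalf d) →
       x ∈ ∁ (embedLow S ∪ shiftUp T ∪ unionBlocksIn P (lowerHalf d) ∪ unionBlocksIn P (upperHalf d))
  ∈J̄ x∈Pj x∉Ī x∉Ī' = x∉p⇒x∈∁p
    (∉-∪⁺ (∉S∪T x∈Pj ∘ p⊆p∪q (shiftUp T)) (∉-∪⁺ (∉S∪T x∈Pj ∘ q⊆p∪q (embedLow S) (shiftUp T)) (∉-∪⁺ x∉Ī x∉Ī')))
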